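{- Let $\epsilon>0$ and let $k$ be a positive integer. (1) If $H$ is a balanced orientation with $n$ vertices, maximum degree $k$, and at least $(0.5+\epsilon)n$ edges, then $H$ is a $(2\epsilon/k,k)$-consistent orientation. (2) If $H$ is an Eulerian orientation with maximum degree $k$, then $H$ is a $(1,k)$-consistent orientation.
   Context: An orientation is a digraph obtained by orienting each edge of a finite simple undirected graph (its underlying graph $\hat H$). $d^+(v)$, $d^-(v)$ denote out- and in-degree; the maximum degree of $H$ is that of $\hat H$. $H$ is balanced if $|d^+(v)-d^-(v)|\le 1$ for all $v$. $H$ is Eulerian if $d^+(v)=d^-(v)$ for all $v$ and $\hat H$ is connected. Define $plus(H)=\sum_{v} d^+(v)d^-(v)$ and $minus(H)=\sum_{v}\left(\binom{d^+(v)}{2}+\binom{d^-(v)}{2}\right)$. For $\epsilon'>0$ and a positive integer $k$, an orientation $H$ on $n$ vertices is $(\epsilon',k)$-consistent if its maximum degree is at most $k$ and $plus(H)-minus(H)\ge\epsilon' n$.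
   Formalization: The parameter ε ranges over the positive rationals. -}

module Defs where

open import Data.Bool using (Bool; true; false; if_then_else_)
open import Data.Nat using (ℕ; zero; suc; _+_; _*_; _⊔_; _≤_; _∸_)
open import Data.Nat.Combinatorics using (_C_)
open import Data.Fin using (Fin)
open import Data.List using (List; map; foldr; allFin)
open import Data.Nat.ListAction using (sum)
open import Data.Integer using (ℤ; +_)
open import Data.Rational using (ℚ; _/_)
import Data.Rational as ℚ
open import Data.Product using (_×_)
open import Data.Sum using (_⊎_)
open import Relation.Binary.PropositionalEquality using (_≡_)

-- An orientation on the vertex set Fin n: arc u v = true means the arc u → v.
-- The underlying graph is simple: no loops, and at most one orientation per pair.
record Orientation (n : ℕ) : Set where
  field
    arc      : Fin n → Fin n → Bool
    loopless : ∀ v → arc v v ≡ false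
    antisym  : ∀ u v → arc u v ≡ true → arc v u ≡ false
open Orientation public

Σᵥ : {n : ℕ} → (Fin n → ℕ) → ℕ
Σᵥ {n} f = sum (map f (allFin n))

indicator : Bool → ℕ
indicator b = if b then 1 else 0

outdeg : {n : ℕ} → Orientation n → Fin n → ℕ
outdeg H v = Σᵥ (λ u → indicator (arc H v u))

indeg : {n : ℕ} → Orientation n → Fin n → ℕ
indeg H v = Σᵥ (λ u → indicator (arc H u v))

deg : {n : ℕ} → Orientation n → Fin n → ℕ
deg H v = outdeg H v + indeg H v

maxDegree : {n : ℕ} → Orientation n → ℕ
maxDegree {n} H = foldr _⊔_ 0 (map (deg H) (allFin n))

edges : {n : ℕ} → Orientation n → ℕ
edges H = Σᵥ (outdeg H)

Balanced : {n : ℕ} → Orientation n → Set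
Balanced H = ∀ v → (outdeg H v ≤ suc (indeg H v)) × (indeg H v ≤ suc (outdeg H v))

Adj : {n : ℕ} → Orientation n → Fin n → Fin n → Set
Adj H u v = (arc H u v ≡ true) ⊎ (arc H v u ≡ true)

data Reach {n : ℕ} (H : Orientation n) : Fin n → Fin n → Set where
  here : ∀ {v} → Reach H v v
  step : ∀ {u v w} → Adj H u v → Reach H v w → Reach H u w

Connected : {n : ℕ} → Orientation n → Set
Connected H = ∀ u v → Reach H u v

Eulerian : {n : ℕ} → Orientation n → Set
Eulerian H = (∀ v → outdeg H v ≡ indeg H v) × Connected H

plus : {n : ℕ} → Orientation n → ℕ
plus H = Σᵥ (λ v → outdeg H v * indeg H v)

minus : {n : ℕ} → Orientation n → ℕ
minus H = Σᵥ (λ v → (outdeg H v C 2) + (indeg H v C 2))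

ℕtoℚ : ℕ → ℚ
ℕtoℚ m = (+ m) / 1

Consistent : {n : ℕ} → ℚ → ℕ → Orientation n → Set
Consistent {n} ε' k H =
  (maxDegree H ≤ k) × (ε' ℚ.* ℕtoℚ n ℚ.≤ ℕtoℚ (plus H) ℚ.- ℕtoℚ (minus H))

module Submission where

-- Everything rests on the identity 2·C(a,2) + a = a².  At a vertex with
-- out-degree a and in-degree b it gives
--   2·(C(a,2) + C(b,2)) + (a + b) = a² + b² ≤ 2ab + 1   when |a − b| ≤ 1,
--   2·C(a,2) + 1 ≤ a²                                   when a = b ≥ 1.
-- Summing over the vertices, and using that both degree sums equal the
-- number of edges m, yields  2·minus + 2m ≤ 2·plus + n  for balanced H and
-- minus + n ≤ plus  for Eulerian H (connectivity forces positive degrees).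
-- In the balanced case  plus − minus ≥ m − n/2 ≥ εn ≥ (2/k)·εn  for k ≥ 2;
-- for k = 1 every degree is at most 1, so 2m ≤ n, hence εn ≤ 0 and
-- 2εn ≤ εn ≤ plus − minus.

open import Defs

module ListSums where
  open import Data.Nat using (ℕ; _+_; _*_; _⊔_; _≤_)
  open import Data.Nat.Properties
    using (+-mono-≤; ≤-refl; ≤-trans; m≤m+n; m≤n+m; m≤m⊔n; m≤n⊔m; *-zeroʳ; *-suc; +-commutativeSemigroup)
  open import Data.Nat.ListAction using (sum)
  open import Data.List using (List; []; _∷_; map; foldr; length)
  open import Data.List.Membership.Propositional using (_∈_)
  open import Data.List.Relation.Unary.Any using (here; there)
  open import Algebra.Properties.CommutativeSemigroup +-commutativeSemigroup using (interchange)
  open import Relation.Binary.PropositionalEquality using (_≡_; refl; cong; trans; sym)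

  sum-map-+ : {A : Set} (f g : A → ℕ) (xs : List A) →
    sum (map (λ x → f x + g x) xs) ≡ sum (map f xs) + sum (map g xs)
  sum-map-+ f g [] = refl
  sum-map-+ f g (x ∷ xs) =
    trans (cong (f x + g x +_) (sum-map-+ f g xs)) (interchange (f x) (g x) _ _)

  sum-map-mono : {A : Set} {f g : A → ℕ} → (∀ x → f x ≤ g x) → (xs : List A) →
    sum (map f xs) ≤ sum (map g xs)
  sum-map-mono f≤g [] = ≤-refl
  sum-map-mono f≤g (x ∷ xs) = +-mono-≤ (f≤g x) (sum-map-mono f≤g xs)

  sum-map-const : {A : Set} (c : ℕ) (xs : List A) → sum (map (λ _ → c) xs) ≡ c * length xs
  sum-map-const c [] = sym (*-zeroʳ c)
  sum-map-const c (x ∷ xs) = trans (cong (c +_) (sum-map-const c xs)) (sym (*-suc c (length xs)))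

  sum-map-swap : {A B : Set} (f : A → B → ℕ) (xs : List A) (ys : List B) →
    sum (map (λ x → sum (map (f x) ys)) xs) ≡ sum (map (λ y → sum (map (λ x → f x y) xs)) ys)
  sum-map-swap f [] ys = sym (sum-map-const 0 ys)
  sum-map-swap f (x ∷ xs) ys =
    trans (cong (sum (map (f x) ys) +_) (sum-map-swap f xs ys))
          (sym (sum-map-+ (f x) (λ y → sum (map (λ x → f x y) xs)) ys))

  ∈⇒≤-sum : {A : Set} (f : A → ℕ) {x : A} {xs : List A} → x ∈ xs → f x ≤ sum (map f xs)
  ∈⇒≤-sum f (here refl) = m≤m+n _ _
  ∈⇒≤-sum f {xs = y ∷ _} (there x∈xs) = ≤-trans (∈⇒≤-sum f x∈xs) (m≤n+m _ (f y))

  ∈⇒≤-max : {A : Set} (f : A → ℕ) {x : A} {xs : List A} → x ∈ xs → f x ≤ foldr _⊔_ 0 (map f xs)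
  ∈⇒≤-max f (here refl) = m≤m⊔n _ _
  ∈⇒≤-max f {xs = y ∷ _} (there x∈xs) = ≤-trans (∈⇒≤-max f x∈xs) (m≤n⊔m (f y) _)

  max-map-zero : {A : Set} (f : A → ℕ) → (∀ x → f x ≡ 0) → (xs : List A) →
    foldr _⊔_ 0 (map f xs) ≡ 0
  max-map-zero f f≡0 [] = refl
  max-map-zero f f≡0 (x ∷ xs) = trans (cong (_⊔ foldr _⊔_ 0 (map f xs)) (f≡0 x)) (max-map-zero f f≡0 xs)

module ChooseTwo where
  open import Data.Nat using (zero; suc; _+_; _*_; _≤_)
  open import Data.Nat.Properties using (≤-antisym; ≤-reflexive; <-cmp; m≤m+n; +-monoʳ-≤)
  open import Data.Nat.Combinatorics using (_C_; nC1≡n; nCk+nC[k+1]≡[n+1]C[k+1])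
  open import Data.Nat.Solver using (module +-*-Solver)
  open +-*-Solver
  open import Relation.Binary.Definitions using (tri<; tri≈; tri>)
  open import Relation.Binary.PropositionalEquality
    using (_≡_; refl; cong; cong₂; trans; sym; subst; module ≡-Reasoning)

  suc-C2 : ∀ a → suc a C 2 ≡ a + a C 2
  suc-C2 a = trans (sym (nCk+nC[k+1]≡[n+1]C[k+1] a 1)) (cong (_+ a C 2) (nC1≡n a))

  twice-C2 : ∀ a → a C 2 + a C 2 + a ≡ a * a
  twice-C2 zero = refl
  twice-C2 (suc a) = begin
    suc a C 2 + suc a C 2 + suc a
      ≡⟨ cong (λ c → c + c + suc a) (suc-C2 a) ⟩
    (a + a C 2) + (a + a C 2) + suc a
      ≡⟨ solve 2 (λ a c → (a :+ c) :+ (a :+ c) :+ (con 1 :+ a)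
                          := (c :+ c :+ a) :+ (a :+ (con 1 :+ a))) refl a (a C 2) ⟩
    (a C 2 + a C 2 + a) + (a + suc a)
      ≡⟨ cong (_+ (a + suc a)) (twice-C2 a) ⟩
    a * a + (a + suc a)
      ≡⟨ solve 1 (λ a → a :* a :+ (a :+ (con 1 :+ a)) := (con 1 :+ a) :* (con 1 :+ a)) refl a ⟩
    suc a * suc a ∎
    where open ≡-Reasoning

  squares-of-close : ∀ a b → a ≤ suc b → b ≤ suc a → a * a + b * b ≤ a * b + a * b + 1
  squares-of-close a b a≤1+b b≤1+a with <-cmp a b
  ... | tri≈ _ refl _ = m≤m+n _ 1
  ... | tri< a<b _ _ with ≤-antisym b≤1+a a<b
  ...   | refl = ≤-reflexive (solve 1 (λ a → a :* a :+ (con 1 :+ a) :* (con 1 :+ a)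
                                           := a :* (con 1 :+ a) :+ a :* (con 1 :+ a) :+ con 1) refl a)
  squares-of-close a b a≤1+b b≤1+a | tri> _ _ a>b with ≤-antisym a≤1+b a>b
  ...   | refl = ≤-reflexive (solve 1 (λ b → (con 1 :+ b) :* (con 1 :+ b) :+ b :* b
                                           := (con 1 :+ b) :* b :+ (con 1 :+ b) :* b :+ con 1) refl b)

  balanced-vertex : ∀ a b → a ≤ suc b → b ≤ suc a →
    (a C 2 + b C 2) + (a C 2 + b C 2) + (a + b) ≤ a * b + a * b + 1
  balanced-vertex a b a≤1+b b≤1+a =
    subst (_≤ a * b + a * b + 1) (sym regroup) (squares-of-close a b a≤1+b b≤1+a)
    where
    regroup : (a C 2 + b C 2) + (a C 2 + b C 2) + (a + b) ≡ a * a + b * b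
    regroup = trans (solve 4 (λ a b c d → (c :+ d) :+ (c :+ d) :+ (a :+ b)
                                        := (c :+ c :+ a) :+ (d :+ d :+ b)) refl a b (a C 2) (b C 2))
                    (cong₂ _+_ (twice-C2 a) (twice-C2 b))

  eulerian-vertex : ∀ a → 1 ≤ a → (a C 2 + a C 2) + 1 ≤ a * a
  eulerian-vertex a 1≤a = subst ((a C 2 + a C 2) + 1 ≤_) (twice-C2 a) (+-monoʳ-≤ (a C 2 + a C 2) 1≤a)

module Degrees where
  open ListSums
  open ChooseTwo using (balanced-vertex; eulerian-vertex)
  open import Data.Nat using (ℕ; zero; suc; _+_; _*_; _≤_; s≤s; z≤n)
  open import Data.Nat.Properties using (≤-trans; ≤-reflexive; <⇒≱; m+n≡0⇒m≡0; m+n≡0⇒n≡0; *-identityˡ)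
  open import Data.Nat.Combinatorics using (_C_)
  open import Data.Bool using (Bool; true)
  open import Data.Fin using (Fin)
  open import Data.List using (allFin)
  open import Data.List.Properties using (length-tabulate)
  open import Data.List.Membership.Propositional.Properties using (∈-allFin)
  open import Data.Product using (_,_)
  open import Data.Sum using (inj₁; inj₂)
  open import Data.Empty using (⊥-elim)
  open import Relation.Nullary using (¬_)
  open import Relation.Binary.PropositionalEquality
    using (_≡_; _≢_; refl; cong; cong₂; trans; sym; subst; subst₂)

  Σᵥ-+ : {n : ℕ} (f g : Fin n → ℕ) → Σᵥ (λ v → f v + g v) ≡ Σᵥ f + Σᵥ g
  Σᵥ-+ f g = sum-map-+ f g (allFin _)

  Σᵥ-mono : {n : ℕ} {f g : Fin n → ℕ} → (∀ v → f v ≤ g v) → Σᵥ f ≤ Σᵥ g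
  Σᵥ-mono f≤g = sum-map-mono f≤g (allFin _)

  Σᵥ-one : (n : ℕ) → Σᵥ {n} (λ _ → 1) ≡ n
  Σᵥ-one n = trans (sum-map-const 1 (allFin n)) (trans (*-identityˡ _) (length-tabulate _))

  positive-if-double-is : ∀ a → a + a ≢ 0 → 1 ≤ a
  positive-if-double-is zero    a+a≢0 = ⊥-elim (a+a≢0 refl)
  positive-if-double-is (suc a) _     = s≤s z≤n

  count-positive : {n : ℕ} (f : Fin n → Bool) {u : Fin n} → f u ≡ true →
    1 ≤ Σᵥ (λ v → indicator (f v))
  count-positive f {u} fu≡true =
    subst (_≤ Σᵥ (λ v → indicator (f v))) (cong indicator fu≡true)
          (∈⇒≤-sum (λ v → indicator (f v)) (∈-allFin u))

  module _ {n : ℕ} (H : Orientation n) where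

    handshake : Σᵥ (indeg H) ≡ edges H
    handshake = sym (sum-map-swap (λ u v → indicator (arc H u v)) (allFin n) (allFin n))

    degree-sum : Σᵥ (deg H) ≡ edges H + edges H
    degree-sum = trans (Σᵥ-+ (outdeg H) (indeg H)) (cong (edges H +_) handshake)

    deg≤maxDegree : ∀ v → deg H v ≤ maxDegree H
    deg≤maxDegree v = ∈⇒≤-max (deg H) (∈-allFin v)

    isolated : ∀ {v w} → deg H v ≡ 0 → ¬ Adj H v w
    isolated {v} deg≡0 (inj₁ v→w) =
      <⇒≱ (count-positive (arc H v) v→w) (≤-reflexive (m+n≡0⇒m≡0 (outdeg H v) deg≡0))
    isolated {v} deg≡0 (inj₂ w→v) =
      <⇒≱ (count-positive (λ u → arc H u v) w→v) (≤-reflexive (m+n≡0⇒n≡0 (outdeg H v) deg≡0))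

    connected-no-isolated : Connected H → maxDegree H ≢ 0 → ∀ v → deg H v ≢ 0
    connected-no-isolated conn max≢0 v deg≡0 = max≢0 (max-map-zero (deg H) all-isolated (allFin n))
      where
      only-v : ∀ {u} → Reach H v u → u ≡ v
      only-v here = refl
      only-v (step v~w _) with isolated deg≡0 v~w
      ... | ()
      all-isolated : ∀ u → deg H u ≡ 0
      all-isolated u = subst (λ x → deg H x ≡ 0) (sym (only-v (conn v u))) deg≡0

    balanced-count : Balanced H →
      minus H + minus H + (edges H + edges H) ≤ plus H + plus H + n
    balanced-count bal = subst₂ _≤_ lhs rhs (Σᵥ-mono vertexwise)
      where
      o = outdeg H
      i = indeg H
      X = λ v → o v C 2 + i v C 2
      Y = λ v → o v * i v
      vertexwise : ∀ v → X v + X v + deg H v ≤ Y v + Y v + 1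
      vertexwise v with bal v
      ... | o≤1+i , i≤1+o = balanced-vertex (o v) (i v) o≤1+i i≤1+o
      lhs : Σᵥ (λ v → X v + X v + deg H v) ≡ minus H + minus H + (edges H + edges H)
      lhs = trans (Σᵥ-+ (λ v → X v + X v) (deg H)) (cong₂ _+_ (Σᵥ-+ X X) degree-sum)
      rhs : Σᵥ (λ v → Y v + Y v + 1) ≡ plus H + plus H + n
      rhs = trans (Σᵥ-+ (λ v → Y v + Y v) (λ _ → 1)) (cong₂ _+_ (Σᵥ-+ Y Y) (Σᵥ-one n))

    eulerian-count : Eulerian H → maxDegree H ≢ 0 → minus H + n ≤ plus H
    eulerian-count (out≡in , conn) max≢0 =
      subst (_≤ plus H) (trans (Σᵥ-+ X (λ _ → 1)) (cong (minus H +_) (Σᵥ-one n))) (Σᵥ-mono vertexwise)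
      where
      X = λ v → outdeg H v C 2 + indeg H v C 2
      out-positive : ∀ v → 1 ≤ outdeg H v
      out-positive v = positive-if-double-is (outdeg H v) λ o+o≡0 →
        connected-no-isolated conn max≢0 v (trans (cong (outdeg H v +_) (sym (out≡in v))) o+o≡0)
      vertexwise : ∀ v → X v + 1 ≤ outdeg H v * indeg H v
      vertexwise v rewrite sym (out≡in v) = eulerian-vertex (outdeg H v) (out-positive v)

    sparse-count : maxDegree H ≤ 1 → edges H + edges H ≤ n
    sparse-count max≤1 =
      subst₂ _≤_ degree-sum (Σᵥ-one n) (Σᵥ-mono (λ v → ≤-trans (deg≤maxDegree v) max≤1))

module RationalBounds where
  open import Data.Nat as ℕ using (suc)
  open import Data.Nat.Coprimality using (1-coprimeTo) renaming (sym to coprime-sym)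
  open import Data.Integer as ℤ using (+_)
  import Data.Integer.Properties as ℤ
  open import Data.Rational
  open import Data.Rational.Properties
  import Data.Rational.Unnormalised as ℚᵘ
  import Data.Rational.Unnormalised.Properties as ℚᵘ
  open import Data.Rational.Solver using (module +-*-Solver)
  open +-*-Solver
  open import Relation.Binary.PropositionalEquality using (_≡_; refl; cong; cong₂; trans; sym; subst; subst₂)

  ℕtoℚ-mkℚ : ∀ m → ℕtoℚ m ≡ mkℚ (+ m) 0 (coprime-sym (1-coprimeTo m))
  ℕtoℚ-mkℚ m = normalize-coprime (coprime-sym (1-coprimeTo m))

  ℕtoℚ-+ : ∀ a b → ℕtoℚ (a ℕ.+ b) ≡ ℕtoℚ a + ℕtoℚ b
  ℕtoℚ-+ a b = trans (cong (_/ 1) numerators) (sym (cong₂ _+_ (ℕtoℚ-mkℚ a) (ℕtoℚ-mkℚ b)))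
    where
    numerators : + (a ℕ.+ b) ≡ (+ a ℤ.* + 1) ℤ.+ (+ b ℤ.* + 1)
    numerators = cong₂ ℤ._+_ (sym (ℤ.*-identityʳ (+ a))) (sym (ℤ.*-identityʳ (+ b)))

  ℕtoℚ-mono : ∀ {a b} → a ℕ.≤ b → ℕtoℚ a ≤ ℕtoℚ b
  ℕtoℚ-mono {a} {b} a≤b = subst₂ _≤_ (sym (ℕtoℚ-mkℚ a)) (sym (ℕtoℚ-mkℚ b))
    (*≤* (subst₂ ℤ._≤_ (sym (ℤ.*-identityʳ (+ a))) (sym (ℤ.*-identityʳ (+ b))) (ℤ.+≤+ a≤b)))

  -- 2/k ≤ 1 once k ≥ 2 (compared as unnormalised fractions: 2·1 ≤ 1·k).
  two-over-≤-one : ∀ j → (+ 2) / suc (suc j) ≤ 1ℚ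
  two-over-≤-one j = toℚᵘ-cancel-≤ (ℚᵘ.≤-respˡ-≃ (ℚᵘ.≃-sym (toℚᵘ-fromℚᵘ (ℚᵘ.mkℚᵘ (+ 2) (suc j))))
                                                   (ℚᵘ.*≤* (ℤ.+≤+ (ℕ.s≤s (ℕ.s≤s ℕ.z≤n)))))

  -- x ≤ y is witnessed by any non-negative s with s = y − x; the
  -- certificates below are non-negative combinations of the hypotheses.
  ≤-by : ∀ {x y} s → 0ℚ ≤ s → s ≡ y - x → x ≤ y
  ≤-by {x} {y} s 0≤s s≡y-x = subst₂ _≤_ (+-identityˡ x) y-x+x≡y (+-monoˡ-≤ x (subst (0ℚ ≤_) s≡y-x 0≤s))
    where
    y-x+x≡y : y - x + x ≡ y
    y-x+x≡y = solve 2 (λ x y → (y :- x) :+ x := y) refl x y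

  0≤- : ∀ {x y} → x ≤ y → 0ℚ ≤ y - x
  0≤- {x} {y} x≤y = subst (_≤ y - x) (+-inverseʳ x) (+-monoˡ-≤ (- x) x≤y)

  0≤* : ∀ {a b} → 0ℚ ≤ a → 0ℚ ≤ b → 0ℚ ≤ a * b
  0≤* {a} {b} 0≤a 0≤b = subst (_≤ a * b) (*-zeroʳ a) (*-monoˡ-≤-nonNeg a {{nonNegative 0≤a}} 0≤b)

  0≤½ : 0ℚ ≤ ½
  0≤½ = *≤* (ℤ.+≤+ ℕ.z≤n)

  surplus-bound : ∀ e N m P M → (½ + e) * N ≤ m → M + M + (m + m) ≤ P + P + N → e * N ≤ P - M
  surplus-bound e N m P M dense count =
    ≤-by (½ * (P + P + N - (M + M + (m + m))) + (m - (½ + e) * N))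
         (+-mono-≤ (0≤* 0≤½ (0≤- count)) (0≤- dense))
         (solve 5 (λ e N m P M →
            con ½ :* (P :+ P :+ N :- (M :+ M :+ (m :+ m))) :+ (m :- (con ½ :+ e) :* N)
              := P :- M :- e :* N) refl e N m P M)

  excess-nonpositive : ∀ e N m → (½ + e) * N ≤ m → m + m ≤ N → e * N ≤ 0ℚ
  excess-nonpositive e N m dense sparse =
    ≤-by (½ * (N - (m + m)) + (m - (½ + e) * N))
         (+-mono-≤ (0≤* 0≤½ (0≤- sparse)) (0≤- dense))
         (solve 3 (λ e N m →
            con ½ :* (N :- (m :+ m)) :+ (m :- (con ½ :+ e) :* N) := con 0ℚ :- e :* N) refl e N m)

  doubled-bound : ∀ e N D → e * N ≤ 0ℚ → e * N ≤ D → e * ((+ 2) / 1) * N ≤ D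
  doubled-bound e N D nonpos bound =
    ≤-by ((D - e * N) + (0ℚ - e * N)) (+-mono-≤ (0≤- bound) (0≤- nonpos))
         (solve 3 (λ e N D → (D :- e :* N) :+ (con 0ℚ :- e :* N) := D :- e :* con ((+ 2) / 1) :* N)
                refl e N D)

  scaled-bound : ∀ e N D t → 0ℚ ≤ e * N → t ≤ 1ℚ → e * N ≤ D → e * t * N ≤ D
  scaled-bound e N D t nonneg t≤1 bound =
    ≤-by ((D - e * N) + (1ℚ - t) * (e * N)) (+-mono-≤ (0≤- bound) (0≤* (0≤- t≤1) nonneg))
         (solve 4 (λ e N D t → (D :- e :* N) :+ (con 1ℚ :- t) :* (e :* N) := D :- e :* t :* N)
                refl e N D t)

  shifted-bound : ∀ N P M → M + N ≤ P → 1ℚ * N ≤ P - M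
  shifted-bound N P M count =
    ≤-by (P - (M + N)) (0≤- count)
         (solve 3 (λ N P M → P :- (M :+ N) := P :- M :- con 1ℚ :* N) refl N P M)

open import Data.Nat using (ℕ; NonZero)
open import Data.Integer using (+_)
open import Data.Rational using (ℚ; _/_; _<_; _≤_; _*_; _+_; 0ℚ; ½; 1ℚ)
open import Data.Product using (_×_; _,_)
open import Relation.Binary.PropositionalEquality using (_≡_)
open import Data.Nat.Properties using (≤-reflexive)
open import Data.Rational.Properties using (<⇒≤)

module Consistency (ε : ℚ) where
  open Degrees
  open RationalBounds
  open import Data.Nat using (suc; ≢-nonZero⁻¹)
  import Data.Nat as ℕ
  import Data.Nat.Properties as ℕ
  open import Data.Rational using (_-_)
  open import Relation.Binary.PropositionalEquality using (_≢_; refl; cong₂; trans; sym; subst; subst₂)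

  module _ {n : ℕ} (H : Orientation n) where
    private
      N = ℕtoℚ n
      m = ℕtoℚ (edges H)
      P = ℕtoℚ (plus H)
      M = ℕtoℚ (minus H)

    balanced-surplus : Balanced H → (½ + ε) * N ≤ m → ε * N ≤ P - M
    balanced-surplus bal dense =
      surplus-bound ε N m P M dense (subst₂ _≤_ lhs rhs (ℕtoℚ-mono (balanced-count H bal)))
      where
      lhs : ℕtoℚ (minus H ℕ.+ minus H ℕ.+ (edges H ℕ.+ edges H)) ≡ M + M + (m + m)
      lhs = trans (ℕtoℚ-+ (minus H ℕ.+ minus H) (edges H ℕ.+ edges H))
                  (cong₂ _+_ (ℕtoℚ-+ (minus H) (minus H)) (ℕtoℚ-+ (edges H) (edges H)))
      rhs : ℕtoℚ (plus H ℕ.+ plus H ℕ.+ n) ≡ P + P + N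
      rhs = trans (ℕtoℚ-+ (plus H ℕ.+ plus H) n) (cong₂ _+_ (ℕtoℚ-+ (plus H) (plus H)) refl)

    balanced-bound : 0ℚ ≤ ε → ∀ k .{{_ : NonZero k}} → Balanced H → maxDegree H ≡ k →
      (½ + ε) * N ≤ m → ε * ((+ 2) / k) * N ≤ P - M
    balanced-bound ε≥0 1 bal max≡1 dense =
      doubled-bound ε N (P - M) (excess-nonpositive ε N m dense sparse) (balanced-surplus bal dense)
      where
      sparse : m + m ≤ N
      sparse = subst (_≤ N) (ℕtoℚ-+ (edges H) (edges H))
                     (ℕtoℚ-mono (sparse-count H (ℕ.≤-reflexive max≡1)))
    balanced-bound ε≥0 (suc (suc j)) bal _ dense =
      scaled-bound ε N (P - M) _ (0≤* ε≥0 (ℕtoℚ-mono {0} {n} ℕ.z≤n)) (two-over-≤-one j)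
                   (balanced-surplus bal dense)

    eulerian-bound : ∀ k .{{_ : NonZero k}} → Eulerian H → maxDegree H ≡ k → 1ℚ * N ≤ P - M
    eulerian-bound k eul max≡k =
      shifted-bound N P M (subst (_≤ P) (ℕtoℚ-+ (minus H) n) (ℕtoℚ-mono (eulerian-count H eul max≢0)))
      where
      max≢0 : maxDegree H ≢ 0
      max≢0 max≡0 = ≢-nonZero⁻¹ k (trans (sym max≡k) max≡0)

proposition1p3 : (ε : ℚ) → 0ℚ < ε → (k : ℕ) → .{{_ : NonZero k}} →
    ((n : ℕ) (H : Orientation n) → Balanced H → maxDegree H ≡ k →
      (½ + ε) * ℕtoℚ n ≤ ℕtoℚ (edges H) →
      Consistent (ε * ((+ 2) / k)) k H)
    × ((n : ℕ) (H : Orientation n) → Eulerian H → maxDegree H ≡ k →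
      Consistent 1ℚ k H)
proposition1p3 ε ε>0 k =
    (λ n H bal max≡k dense → ≤-reflexive max≡k , balanced-bound H (<⇒≤ ε>0) k bal max≡k dense)
  , (λ n H eul max≡k → ≤-reflexive max≡k , eulerian-bound H k eul max≡k)
  where open Consistency ε
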